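{- Let $n,r,t,s$ be integers with $n/r-t$ a nonnegative integer, and let $H=(V,E)$ be a hypergraph with $|V|\le n$ whose $\tfrac{tr}{2}$-shifted $r$-centered discrepancy $x$ satisfies $x>\frac{r(r-1)(s-1)+rt}{2}$. Then \[ \chi\left[KH\left(n,r,\tfrac nr-t,s\right)\right]\le 2|E|. \]
   Context: The generalized Kneser hypergraph $KH(n,r,k,s)$ has vertex set $\binom{[n]}{k}$ (all $k$-subsets of $[n]=\{1,\dots,n\}$) and hyperedges all $r$-element sets $\{v_1,\dots,v_r\}$ of vertices with $|v_i\cap v_j|<s$ for all $i\ne j$; its chromatic number $\chi$ is the minimum number of colors in a vertex coloring with no monochromatic hyperedge. For a 2-coloring (red/blue) of the vertices of a hypergraph and a number $w$, the $w$-shifted $r$-centered discrepancy of the coloring is the maximum over edges $e$ of $|(r-1)\mathrm{blue}(e)-\mathrm{red}(e)+w|$, where $\mathrm{blue}(e),\mathrm{red}(e)$ count blue and red vertices of $e$; the $w$-shifted $r$-centered discrepancy of the hypergraph is the minimum of this over all 2-colorings of its vertices. -}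

module Defs where

open import Data.Nat using (ℕ; _≤_)
open import Data.Integer as ℤ using (ℤ; +_; _-_; _*_; _+_; _<_; ∣_∣)
open import Data.Fin using (Fin)
open import Data.Fin.Subset using (Subset; _∩_; ∁) renaming (∣_∣ to size)
open import Data.Product using (Σ; ∃; _×_)
open import Relation.Binary.PropositionalEquality using (_≡_; _≢_)
open import Relation.Nullary using (¬_)
open import Function.Definitions using (Injective)

-- Finite hypergraphs: vertex set Fin m, edges indexed by Fin p
-- (injectively, so that |E| = p counts distinct edges).

record Hypergraph : Set where
  field
    m     : ℕ
    p     : ℕ
    edge  : Fin p → Subset m
    edge-injective : Injective _≡_ _≡_ edge

open Hypergraph public

-- A red/blue 2-colouring of the vertices of H is given by its set of blue
-- vertices; the remaining vertices are red.
blue red : ∀ {m} → Subset m → Subset m → ℕ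
blue c e = size (e ∩ c)
red  c e = size (e ∩ ∁ c)

-- Twice the quantity  (r-1) blue(e) - red(e) + w  with w = t r / 2 :
--   2 (r-1) blue(e) - 2 red(e) + t r .
twiceShifted : ∀ {m} (r : ℕ) (t : ℤ) → Subset m → Subset m → ℤ
twiceShifted r t c e =
  (+ 2 * (+ r - + 1) * + blue c e - + 2 * + red c e) + t * + r

-- "The (t r / 2)-shifted r-centered discrepancy of H is > b / 2", i.e.
--   min over colourings of max over edges of |(r-1)blue(e)-red(e)+tr/2| > b/2,
-- unfolded (min-max over finite sets, with both sides doubled):
-- every colouring has an edge whose value exceeds b/2.
DiscGreater : Hypergraph → (r : ℕ) → (t : ℤ) → (b : ℤ) → Set
DiscGreater H r t b =
  (c : Subset (m H)) → ∃ λ (i : Fin (p H)) → b < + ∣ twiceShifted r t c (edge H i) ∣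

KVertex : ℕ → ℕ → Set
KVertex n k = Σ (Subset n) (λ v → size v ≡ k)

IsKHEdge : ∀ {n k} (r : ℕ) (s : ℤ) → (Fin r → KVertex n k) → Set
IsKHEdge r s vs =
  Injective _≡_ _≡_ vs ×
  (∀ i j → i ≢ j → + size (Data.Product.proj₁ (vs i) ∩ Data.Product.proj₁ (vs j)) < s)

ProperKHColouring : (n r k : ℕ) (s : ℤ) (c : ℕ) → (KVertex n k → Fin c) → Set
ProperKHColouring n r k s c f =
  (vs : Fin r → KVertex n k) → IsKHEdge r s vs → ¬ (∀ i j → f (vs i) ≡ f (vs j))

KHChromaticAtMost : (n r k : ℕ) (s : ℤ) (c : ℕ) → Set
KHChromaticAtMost n r k s c = ∃ λ (f : KVertex n k → Fin c) → ProperKHColouring n r k s c f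

-- Colour a k-subset A of [n] by an edge e of H on which the restriction of A to V(H) has
-- large discrepancy, together with the sign of the shifted value. On a monochromatic
-- hyperedge A₁, …, A_r the doubled values T_j = 2r|e ∩ A_j| - 2|e| + tr then all exceed b on
-- the same side, hence so does their mean. With the coverage δᵢ = #{j : i ∈ A_j} and the
-- indicator x of e, this mean is 2Σ xᵢδᵢ - 2Σ xᵢ + tr, and it lies in [-b, b]: coordinatewise
-- (δ - 1)(δ - 2x) and (δ - 1)(δ - 2 + 2x) are products of consecutive integers, hence
-- nonnegative; sparseness gives Σ δᵢ² = Σ_{j,j'} |A_j ∩ A_j'| ≤ r(k + (r - 1)(s - 1)); and
-- n = (k + t)r.

module Submission where

open import Defs

module KneserColouring where

  open import Data.Bool using (Bool; true; false; _∧_; not)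
  open import Data.Nat as ℕ using (ℕ; zero; suc; z≤n)
  open import Data.Nat.Properties using (+-suc)
  open import Data.Integer as ℤ using (ℤ; +_; -[1+_]; _+_; _-_; _*_; -_; _≤_; _<_; ∣_∣; 0ℤ; 1ℤ; -1ℤ; +≤+)
  import Data.Integer.Properties as ℤ
  open import Data.Integer.Tactic.RingSolver using (solve-∀)
  open import Data.Fin using (Fin; zero; suc; punchIn; combine)
  open import Data.Fin.Properties using (punchInᵢ≢i; combine-injective)
  open import Data.Fin.Subset using (Subset; _∩_; ∁; ⊥; inside; outside) renaming (∣_∣ to size)
  open import Data.Fin.Subset.Properties using (∩-idem; ∩-zeroˡ; ∣⊥∣≡0)
  open import Data.Vec using ([]; _∷_; lookup; take; drop; _++_)
  open import Data.Vec.Properties using (lookup-zipWith; take++drop≡id; take-map; zipWith-++)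
  open import Data.Product using (∃₂; _×_; _,_; proj₁; proj₂)
  open import Function using (_∘_)
  open import Relation.Binary.PropositionalEquality
  open import Relation.Nullary using (¬_)
  open import Algebra.Properties.Semiring.Sum ℤ.+-*-semiring
    using (sum; sum-syntax; sum-cong-≗; ∑-comm; ∑-distrib-+; *-distribˡ-sum; *-distribʳ-sum; sum-remove)

  ∑-mono-≤ : ∀ {n} {f g : Fin n → ℤ} → (∀ i → f i ≤ g i) → sum f ≤ sum g
  ∑-mono-≤ {zero}  _   = ℤ.≤-refl
  ∑-mono-≤ {suc n} f≤g = ℤ.+-mono-≤ (f≤g zero) (∑-mono-≤ (f≤g ∘ suc))

  ∑-mono-< : ∀ {n} {f g : Fin (suc n) → ℤ} → (∀ i → f i < g i) → sum f < sum g
  ∑-mono-< f<g = ℤ.+-mono-<-≤ (f<g zero) (∑-mono-≤ (ℤ.<⇒≤ ∘ f<g ∘ suc))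

  ∑-const : ∀ n c → ∑[ i < n ] c ≡ + n * c
  ∑-const zero    c = sym (ℤ.*-zeroˡ c)
  ∑-const (suc n) c = trans (cong (_+_ c) (∑-const n c)) (sym (ℤ.suc-* (+ n) c))

  ∑-affine : ∀ {n} a c (f : Fin n → ℤ) → ∑[ i < n ] (a * f i + c) ≡ a * sum f + + n * c
  ∑-affine {n} a c f =
    trans (∑-distrib-+ (λ i → a * f i) (λ _ → c)) (cong₂ _+_ (sym (*-distribˡ-sum a f)) (∑-const n c))

  ∑≤pick+bound : ∀ {n} (f : Fin (suc n) → ℤ) i c → (∀ j → j ≢ i → f j ≤ c) → sum f ≤ f i + + n * c
  ∑≤pick+bound {n} f i c off = begin
    sum f                                ≡⟨ sum-remove {i = i} f ⟩
    f i + ∑[ j < n ] f (punchIn i j)     ≤⟨ ℤ.+-monoʳ-≤ (f i) (∑-mono-≤ (λ j → off _ (punchInᵢ≢i i j))) ⟩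
    f i + ∑[ j < n ] c                   ≡⟨ cong (_+_ (f i)) (∑-const n c) ⟩
    f i + + n * c                        ∎
    where open ℤ.≤-Reasoning

  ∑≤*⇒¬all> : ∀ {n} (f : Fin (suc n) → ℤ) c → sum f ≤ + suc n * c → ¬ (∀ i → c < f i)
  ∑≤*⇒¬all> {n} f c ∑f≤ c<f = ℤ.≤⇒≯ ∑f≤ (subst (_< sum f) (∑-const (suc n) c) (∑-mono-< c<f))

  *≤∑⇒¬all< : ∀ {n} (f : Fin (suc n) → ℤ) c → + suc n * c ≤ sum f → ¬ (∀ i → f i < c)
  *≤∑⇒¬all< {n} f c ≤∑f f<c = ℤ.≤⇒≯ ≤∑f (subst (sum f <_) (∑-const (suc n) c) (∑-mono-< f<c))

  ≤-by-slack : ∀ {i j} w → i + w ≡ j → 0ℤ ≤ w → i ≤ j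
  ≤-by-slack {i} w refl 0≤w = subst (_≤ i + w) (ℤ.+-identityʳ i) (ℤ.+-monoʳ-≤ i 0≤w)

  i<j⇒i≤j-1 : ∀ {i j} → i < j → i ≤ j - 1ℤ
  i<j⇒i≤j-1 {i} {j} i<j = subst (i ≤_) (ℤ.+-comm -1ℤ j) (ℤ.i<j⇒i≤pred[j] i<j)

  0≤i*[i-1] : ∀ i → 0ℤ ≤ i * (i - 1ℤ)
  0≤i*[i-1] (+ zero)        = +≤+ z≤n
  0≤i*[i-1] (+ suc zero)    = +≤+ z≤n
  0≤i*[i-1] (+ suc (suc n)) = +≤+ z≤n
  0≤i*[i-1] -[1+ n ]        = +≤+ z≤n

  ⟦_⟧ : Bool → ℤ
  ⟦ true  ⟧ = 1ℤ
  ⟦ false ⟧ = 0ℤ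

  ⟦∧⟧ : ∀ x y → ⟦ x ∧ y ⟧ ≡ ⟦ x ⟧ * ⟦ y ⟧
  ⟦∧⟧ true  true  = refl
  ⟦∧⟧ true  false = refl
  ⟦∧⟧ false _     = refl

  2xδ+δ≤δ²+2x : ∀ x δ → + 2 * (⟦ x ⟧ * δ) + δ ≤ δ * δ + + 2 * ⟦ x ⟧
  2xδ+δ≤δ²+2x false δ = ≤-by-slack (δ * (δ - 1ℤ)) (eq δ) (0≤i*[i-1] δ)
    where eq : ∀ δ → + 2 * (0ℤ * δ) + δ + δ * (δ - 1ℤ) ≡ δ * δ + + 2 * 0ℤ
          eq = solve-∀
  2xδ+δ≤δ²+2x true  δ = ≤-by-slack ((δ - 1ℤ) * (δ - 1ℤ - 1ℤ)) (eq δ) (0≤i*[i-1] (δ - 1ℤ))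
    where eq : ∀ δ → + 2 * (1ℤ * δ) + δ + (δ - 1ℤ) * (δ - 1ℤ - 1ℤ) ≡ δ * δ + + 2 * 1ℤ
          eq = solve-∀

  3δ+2x≤δ²+2xδ+2 : ∀ x δ → + 3 * δ + + 2 * ⟦ x ⟧ ≤ δ * δ + + 2 * (⟦ x ⟧ * δ) + + 2
  3δ+2x≤δ²+2xδ+2 false δ = ≤-by-slack ((δ - 1ℤ) * (δ - 1ℤ - 1ℤ)) (eq δ) (0≤i*[i-1] (δ - 1ℤ))
    where eq : ∀ δ → + 3 * δ + + 2 * 0ℤ + (δ - 1ℤ) * (δ - 1ℤ - 1ℤ) ≡ δ * δ + + 2 * (0ℤ * δ) + + 2
          eq = solve-∀
  3δ+2x≤δ²+2xδ+2 true  δ = ≤-by-slack (δ * (δ - 1ℤ)) (eq δ) (0≤i*[i-1] δ)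
    where eq : ∀ δ → + 3 * δ + + 2 * 1ℤ + δ * (δ - 1ℤ) ≡ δ * δ + + 2 * (1ℤ * δ) + + 2
          eq = solve-∀

  𝟙 : ∀ {n} → Subset n → Fin n → ℤ
  𝟙 p i = ⟦ lookup p i ⟧

  _·_ : ∀ {n} → (Fin n → ℤ) → (Fin n → ℤ) → ℤ
  f · g = sum (λ i → f i * g i)

  size≡∑𝟙 : ∀ {n} (p : Subset n) → + size p ≡ sum (𝟙 p)
  size≡∑𝟙 []            = refl
  size≡∑𝟙 (inside  ∷ p) = cong (_+_ 1ℤ) (size≡∑𝟙 p)
  size≡∑𝟙 (outside ∷ p) = trans (size≡∑𝟙 p) (sym (ℤ.+-identityˡ _))

  size-∩≡𝟙·𝟙 : ∀ {n} (p q : Subset n) → + size (p ∩ q) ≡ 𝟙 p · 𝟙 q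
  size-∩≡𝟙·𝟙 p q = trans (size≡∑𝟙 (p ∩ q))
    (sum-cong-≗ λ i → trans (cong ⟦_⟧ (lookup-zipWith _∧_ i p q)) (⟦∧⟧ (lookup p i) (lookup q i)))

  2𝟙·δ+∑δ≤δ·δ+2∑𝟙 : ∀ {n} (u : Subset n) (δ : Fin n → ℤ) →
                    + 2 * (𝟙 u · δ) + sum δ ≤ δ · δ + + 2 * sum (𝟙 u)
  2𝟙·δ+∑δ≤δ·δ+2∑𝟙 {n} u δ = begin
    + 2 * (𝟙 u · δ) + sum δ                    ≡⟨ cong (_+ sum δ) (*-distribˡ-sum (+ 2) (λ i → 𝟙 u i * δ i)) ⟩
    ∑[ i < n ] (+ 2 * (𝟙 u i * δ i)) + sum δ   ≡⟨ ∑-distrib-+ (λ i → + 2 * (𝟙 u i * δ i)) δ ⟨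
    ∑[ i < n ] (+ 2 * (𝟙 u i * δ i) + δ i)     ≤⟨ ∑-mono-≤ (λ i → 2xδ+δ≤δ²+2x (lookup u i) (δ i)) ⟩
    ∑[ i < n ] (δ i * δ i + + 2 * 𝟙 u i)       ≡⟨ ∑-distrib-+ (λ i → δ i * δ i) (λ i → + 2 * 𝟙 u i) ⟩
    δ · δ + ∑[ i < n ] (+ 2 * 𝟙 u i)           ≡⟨ cong (_+_ (δ · δ)) (*-distribˡ-sum (+ 2) (𝟙 u)) ⟨
    δ · δ + + 2 * sum (𝟙 u)                    ∎
    where open ℤ.≤-Reasoning

  3∑δ+2∑𝟙≤δ·δ+2𝟙·δ+2n : ∀ {n} (u : Subset n) (δ : Fin n → ℤ) →
                        + 3 * sum δ + + 2 * sum (𝟙 u) ≤ δ · δ + + 2 * (𝟙 u · δ) + + n * + 2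
  3∑δ+2∑𝟙≤δ·δ+2𝟙·δ+2n {n} u δ = begin
    + 3 * sum δ + + 2 * sum (𝟙 u)
      ≡⟨ cong₂ _+_ (*-distribˡ-sum (+ 3) δ) (*-distribˡ-sum (+ 2) (𝟙 u)) ⟩
    ∑[ i < n ] (+ 3 * δ i) + ∑[ i < n ] (+ 2 * 𝟙 u i)
      ≡⟨ ∑-distrib-+ (λ i → + 3 * δ i) (λ i → + 2 * 𝟙 u i) ⟨
    ∑[ i < n ] (+ 3 * δ i + + 2 * 𝟙 u i)
      ≤⟨ ∑-mono-≤ (λ i → 3δ+2x≤δ²+2xδ+2 (lookup u i) (δ i)) ⟩
    ∑[ i < n ] (δ i * δ i + + 2 * (𝟙 u i * δ i) + + 2)
      ≡⟨ ∑-distrib-+ (λ i → δ i * δ i + + 2 * (𝟙 u i * δ i)) (λ _ → + 2) ⟩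
    ∑[ i < n ] (δ i * δ i + + 2 * (𝟙 u i * δ i)) + ∑[ i < n ] (+ 2)
      ≡⟨ cong₂ _+_ (∑-distrib-+ (λ i → δ i * δ i) (λ i → + 2 * (𝟙 u i * δ i))) (∑-const n (+ 2)) ⟩
    δ · δ + ∑[ i < n ] (+ 2 * (𝟙 u i * δ i)) + + n * + 2
      ≡⟨ cong (λ z → δ · δ + z + + n * + 2) (*-distribˡ-sum (+ 2) (λ i → 𝟙 u i * δ i)) ⟨
    δ · δ + + 2 * (𝟙 u · δ) + + n * + 2
      ∎
    where open ℤ.≤-Reasoning

  coverage : ∀ {n r} → (Fin r → Subset n) → Fin n → ℤ
  coverage A i = sum (λ j → 𝟙 (A j) i)

  module _ {n r} (A : Fin r → Subset n) where

    ∑size≡∑coverage : ∑[ j < r ] (+ size (A j)) ≡ sum (coverage A)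
    ∑size≡∑coverage = trans (sum-cong-≗ (size≡∑𝟙 ∘ A)) (∑-comm (𝟙 ∘ A))

    ∑size-∩≡𝟙·coverage : ∀ u → ∑[ j < r ] (+ size (u ∩ A j)) ≡ 𝟙 u · coverage A
    ∑size-∩≡𝟙·coverage u = begin
      ∑[ j < r ] (+ size (u ∩ A j))            ≡⟨ sum-cong-≗ (size-∩≡𝟙·𝟙 u ∘ A) ⟩
      ∑[ j < r ] ∑[ i < n ] (𝟙 u i * 𝟙 (A j) i) ≡⟨ ∑-comm (λ j i → 𝟙 u i * 𝟙 (A j) i) ⟩
      ∑[ i < n ] ∑[ j < r ] (𝟙 u i * 𝟙 (A j) i) ≡⟨ sum-cong-≗ (λ i → *-distribˡ-sum (𝟙 u i) (λ j → 𝟙 (A j) i)) ⟨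
      𝟙 u · coverage A                        ∎
      where open ≡-Reasoning

    ∑∑size-∩≡coverage·coverage : ∑[ i < r ] ∑[ j < r ] (+ size (A i ∩ A j)) ≡ coverage A · coverage A
    ∑∑size-∩≡coverage·coverage = begin
      ∑[ i < r ] ∑[ j < r ] (+ size (A i ∩ A j))               ≡⟨ sum-cong-≗ (∑size-∩≡𝟙·coverage ∘ A) ⟩
      ∑[ j < r ] ∑[ i < n ] (𝟙 (A j) i * coverage A i)         ≡⟨ ∑-comm (λ j i → 𝟙 (A j) i * coverage A i) ⟩
      ∑[ i < n ] ∑[ j < r ] (𝟙 (A j) i * coverage A i)         ≡⟨ sum-cong-≗ (λ i → *-distribʳ-sum (coverage A i) (λ j → 𝟙 (A j) i)) ⟨
      coverage A · coverage A                                ∎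
      where open ≡-Reasoning

  size-++⊥ : ∀ {m} d (p : Subset m) → size (p ++ ⊥ {d}) ≡ size p
  size-++⊥ d []            = ∣⊥∣≡0 d
  size-++⊥ d (inside  ∷ p) = cong suc (size-++⊥ d p)
  size-++⊥ d (outside ∷ p) = size-++⊥ d p

  size-∩-take : ∀ {m d} (e : Subset m) (A : Subset (m ℕ.+ d)) → size (e ∩ take m A) ≡ size ((e ++ ⊥) ∩ A)
  size-∩-take {m} {d} e A = sym (begin
    size ((e ++ ⊥) ∩ A)                         ≡⟨ cong (λ B → size ((e ++ ⊥) ∩ B)) (take++drop≡id m A) ⟨
    size ((e ++ ⊥) ∩ (take m A ++ drop m A))    ≡⟨ cong size (zipWith-++ _∧_ e ⊥ (take m A) (drop m A)) ⟩
    size ((e ∩ take m A) ++ (⊥ ∩ drop m A))     ≡⟨ cong (λ q → size ((e ∩ take m A) ++ q)) (∩-zeroˡ (drop m A)) ⟩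
    size ((e ∩ take m A) ++ ⊥)                  ≡⟨ size-++⊥ d (e ∩ take m A) ⟩
    size (e ∩ take m A)                         ∎)
    where open ≡-Reasoning

  twiceShifted-take : ∀ {m d} r t (A : Subset (m ℕ.+ d)) (e : Subset m) →
                      twiceShifted r t (take m A) e ≡ twiceShifted r t A (e ++ ⊥)
  twiceShifted-take {m} r t A e =
    cong₂ (λ B R → (+ 2 * (+ r - + 1) * + B - + 2 * + R) + t * + r)
          (size-∩-take e A)
          (trans (cong (size ∘ (e ∩_)) (sym (take-map not m A))) (size-∩-take e (∁ A)))

  size-∩∁+size-∩ : ∀ {n} (p q : Subset n) → size (p ∩ ∁ q) ℕ.+ size (p ∩ q) ≡ size p
  size-∩∁+size-∩ []            []            = refl
  size-∩∁+size-∩ (inside  ∷ p) (inside  ∷ q) = trans (+-suc _ _) (cong suc (size-∩∁+size-∩ p q))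
  size-∩∁+size-∩ (inside  ∷ p) (outside ∷ q) = cong suc (size-∩∁+size-∩ p q)
  size-∩∁+size-∩ (outside ∷ p) (_       ∷ q) = size-∩∁+size-∩ p q

  twiceShifted≡affine-blue : ∀ {n} r t (c u : Subset n) →
                  twiceShifted r t c u ≡ + 2 * + r * + size (u ∩ c) + (t * + r - + 2 * + size u)
  twiceShifted≡affine-blue r t c u =
    trans (eq (+ r) (+ blue c u) (+ red c u) t)
          (cong (λ E → + 2 * + r * + blue c u + (t * + r - + 2 * + E)) (size-∩∁+size-∩ u c))
    where eq : ∀ r B R t → (+ 2 * (r - + 1) * B - + 2 * R) + t * r ≡ + 2 * r * B + (t * r - + 2 * (R + B))
          eq = solve-∀

  -- S, E, Q, K, N stand for Σ xᵢδᵢ, Σ xᵢ, Σ δᵢ², Σ δᵢ and n; L is the mean of the T_j.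
  mean-bounds : ∀ ρ k t s S E Q K N → K ≡ ρ * k → N ≡ (k + t) * ρ →
                + 2 * S + K ≤ Q + + 2 * E →
                + 3 * K + + 2 * E ≤ Q + + 2 * S + N * + 2 →
                Q ≤ ρ * (k + (ρ - + 1) * (s - + 1)) →
                let b = ρ * (ρ - + 1) * (s - + 1) + ρ * t
                    L = + 2 * S + (t * ρ - + 2 * E)
                in L ≤ b × - b ≤ L
  mean-bounds ρ k t s S E Q _ _ refl refl low high Q≤ =
    ≤-by-slack _ (upper ρ k t s S E Q) (ℤ.+-mono-≤ (ℤ.i≤j⇒0≤j-i low) (ℤ.i≤j⇒0≤j-i Q≤)) ,
    ≤-by-slack _ (lower ρ k t s S E Q) (ℤ.+-mono-≤ (ℤ.i≤j⇒0≤j-i high) (ℤ.i≤j⇒0≤j-i Q≤))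
    where
      upper : ∀ ρ k t s S E Q →
              + 2 * S + (t * ρ - + 2 * E)
                + ((Q + + 2 * E - (+ 2 * S + ρ * k)) + (ρ * (k + (ρ - + 1) * (s - + 1)) - Q))
              ≡ ρ * (ρ - + 1) * (s - + 1) + ρ * t
      upper = solve-∀
      lower : ∀ ρ k t s S E Q →
              - (ρ * (ρ - + 1) * (s - + 1) + ρ * t)
                + ((Q + + 2 * S + (k + t) * ρ * + 2 - (+ 3 * (ρ * k) + + 2 * E))
                   + (ρ * (k + (ρ - + 1) * (s - + 1)) - Q))
              ≡ + 2 * S + (t * ρ - + 2 * E)
      lower = solve-∀

  module _ {n r' k : ℕ} {s : ℤ} (A : Fin (suc r') → Subset n)
           (size-A : ∀ j → size (A j) ≡ k)
           (sparse : ∀ i j → i ≢ j → + size (A i ∩ A j) < s) where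

    ∑coverage≡rk : sum (coverage A) ≡ + suc r' * + k
    ∑coverage≡rk = trans (sym (∑size≡∑coverage A)) (trans (sum-cong-≗ (cong +_ ∘ size-A)) (∑-const (suc r') (+ k)))

    coverage·coverage≤ : coverage A · coverage A ≤ + suc r' * (+ k + + r' * (s - 1ℤ))
    coverage·coverage≤ = begin
      coverage A · coverage A                                  ≡⟨ ∑∑size-∩≡coverage·coverage A ⟨
      ∑[ i < suc r' ] ∑[ j < suc r' ] (+ size (A i ∩ A j))     ≤⟨ ∑-mono-≤ row ⟩
      ∑[ i < suc r' ] (+ k + + r' * (s - 1ℤ))                  ≡⟨ ∑-const (suc r') _ ⟩
      + suc r' * (+ k + + r' * (s - 1ℤ))                       ∎
      where
        open ℤ.≤-Reasoning
        row : ∀ i → ∑[ j < suc r' ] (+ size (A i ∩ A j)) ≤ + k + + r' * (s - 1ℤ)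
        row i = ℤ.≤-trans
          (∑≤pick+bound (λ j → + size (A i ∩ A j)) i (s - 1ℤ) (λ j j≢i → i<j⇒i≤j-1 (sparse i j (j≢i ∘ sym))))
          (ℤ.≤-reflexive (cong (λ z → + z + + r' * (s - 1ℤ)) (trans (cong size (∩-idem (A i))) (size-A i))))

    KH-edge-balanced : ∀ {t} → (+ k + t) * + suc r' ≡ + n → (u : Subset n) →
      let b = + suc r' * (+ suc r' - + 1) * (s - + 1) + + suc r' * t
          T = λ j → twiceShifted (suc r') t (A j) u
      in ¬ (∀ j → b < T j) × ¬ (∀ j → b < - T j)
    KH-edge-balanced {t} n≡ u =
      ∑≤*⇒¬all> T b (subst (_≤ ρ * b) (sym ∑T≡ρL) (ℤ.*-monoˡ-≤-nonNeg ρ L≤b)) ,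
      λ b<-T → *≤∑⇒¬all< T (- b) (subst (ρ * - b ≤_) (sym ∑T≡ρL) (ℤ.*-monoˡ-≤-nonNeg ρ -b≤L))
                 (λ j → subst (_< - b) (ℤ.neg-involutive (T j)) (ℤ.neg-mono-< (b<-T j)))
      where
        ρ b L : ℤ
        ρ = + suc r'
        b = ρ * (ρ - + 1) * (s - + 1) + ρ * t
        L = + 2 * (𝟙 u · coverage A) + (t * ρ - + 2 * sum (𝟙 u))
        T : Fin (suc r') → ℤ
        T j = twiceShifted (suc r') t (A j) u

        ∑T≡ρL : sum T ≡ ρ * L
        ∑T≡ρL = begin
          sum T
            ≡⟨ sum-cong-≗ (λ j → twiceShifted≡affine-blue (suc r') t (A j) u) ⟩
          ∑[ j < suc r' ] (+ 2 * ρ * + size (u ∩ A j) + (t * ρ - + 2 * + size u))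
            ≡⟨ ∑-affine (+ 2 * ρ) (t * ρ - + 2 * + size u) (λ j → + size (u ∩ A j)) ⟩
          + 2 * ρ * ∑[ j < suc r' ] (+ size (u ∩ A j)) + ρ * (t * ρ - + 2 * + size u)
            ≡⟨ cong₂ (λ S E → + 2 * ρ * S + ρ * (t * ρ - + 2 * E)) (∑size-∩≡𝟙·coverage A u) (size≡∑𝟙 u) ⟩
          + 2 * ρ * (𝟙 u · coverage A) + ρ * (t * ρ - + 2 * sum (𝟙 u))
            ≡⟨ factor ρ t (𝟙 u · coverage A) (sum (𝟙 u)) ⟩
          ρ * L
            ∎
          where
            open ≡-Reasoning
            factor : ∀ ρ t S E → + 2 * ρ * S + ρ * (t * ρ - + 2 * E) ≡ ρ * (+ 2 * S + (t * ρ - + 2 * E))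
            factor = solve-∀

        L≤b×-b≤L : L ≤ b × - b ≤ L
        L≤b×-b≤L = mean-bounds ρ (+ k) t s (𝟙 u · coverage A) (sum (𝟙 u)) (coverage A · coverage A)
          (sum (coverage A)) (+ n) ∑coverage≡rk (sym n≡)
          (2𝟙·δ+∑δ≤δ·δ+2∑𝟙 u (coverage A)) (3∑δ+2∑𝟙≤δ·δ+2𝟙·δ+2n u (coverage A)) coverage·coverage≤

        L≤b : L ≤ b
        L≤b = proj₁ L≤b×-b≤L
        -b≤L : - b ≤ L
        -b≤L = proj₂ L≤b×-b≤L

  sgn : ℤ → Fin 2
  sgn (+ _)    = zero
  sgn -[1+ _ ] = suc zero

  signed : Fin 2 → ℤ → ℤ
  signed zero    i = i
  signed (suc _) i = - i

  +∣i∣≡signed-sgn : ∀ i → + ∣ i ∣ ≡ signed (sgn i) i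
  +∣i∣≡signed-sgn (+ _)    = refl
  +∣i∣≡signed-sgn -[1+ _ ] = refl

  ¬uniform-signed : ∀ {r} (f : Fin r → ℤ) b σ →
                    ¬ (∀ j → b < f j) × ¬ (∀ j → b < - f j) → ¬ (∀ j → b < signed σ (f j))
  ¬uniform-signed f b zero          (¬pos , _) = ¬pos
  ¬uniform-signed f b (suc zero)    (_ , ¬neg) = ¬neg
  ¬uniform-signed f b (suc (suc ())) _

  module _ (H : Hypergraph) (d r : ℕ) (t b : ℤ) (disc : DiscGreater H r t b) where

    private
      witness : Subset (m H ℕ.+ d) → Fin (p H)
      witness A = proj₁ (disc (take (m H) A))

      value : Subset (m H ℕ.+ d) → ℤ
      value A = twiceShifted r t A (edge H (witness A) ++ ⊥)

    discrepancyColouring : ∀ {k} → KVertex (m H ℕ.+ d) k → Fin (2 ℕ.* p H)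
    discrepancyColouring (A , _) = combine (sgn (value A)) (witness A)

    monochromatic⇒uniform : ∀ {r' k} (vs : Fin (suc r') → KVertex (m H ℕ.+ d) k) →
      (∀ i j → discrepancyColouring (vs i) ≡ discrepancyColouring (vs j)) →
      ∃₂ λ σ u → ∀ j → b < signed σ (twiceShifted r t (proj₁ (vs j)) u)
    monochromatic⇒uniform {r'} vs mono = sgn (value (A zero)) , edge H (witness (A zero)) ++ ⊥ , uniform
      where
        A : Fin (suc r') → Subset (m H ℕ.+ d)
        A = proj₁ ∘ vs
        large : ∀ B → b < signed (sgn (value B)) (value B)
        large B = subst (b <_)
          (trans (cong (+_ ∘ ∣_∣) (twiceShifted-take r t B (edge H (witness B)))) (+∣i∣≡signed-sgn (value B)))
          (proj₂ (disc (take (m H) B)))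
        uniform : ∀ j → b < signed (sgn (value (A zero))) (twiceShifted r t (A j) (edge H (witness (A zero)) ++ ⊥))
        uniform j
          with combine-injective (sgn (value (A j))) (witness (A j))
                                 (sgn (value (A zero))) (witness (A zero)) (mono j zero)
        ... | σ≡ , i≡ =
          subst₂ (λ σ i → b < signed σ (twiceShifted r t (A j) (edge H i ++ ⊥))) σ≡ i≡ (large (A j))

open KneserColouring using (discrepancyColouring; monochromatic⇒uniform; KH-edge-balanced; ¬uniform-signed)
open import Data.Nat using (ℕ; zero; suc; _≤_; NonZero)
open import Data.Nat.Properties using (m≤n⇒∃[o]m+o≡n)
open import Data.Integer using (ℤ; +_; _-_; _*_; _+_)
open import Data.Product using (_,_; proj₁; proj₂)
open import Function using (_∘_)
open import Relation.Binary.PropositionalEquality using (_≡_; refl)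

lemma3 : (n r k : ℕ) (t s : ℤ) → .{{_ : NonZero r}} →
         -- n / r - t = k is a nonnegative integer
         (+ k + t) * + r ≡ + n →
         (H : Hypergraph) → m H ≤ n →
         -- (tr/2)-shifted r-centered discrepancy > (r(r-1)(s-1) + rt)/2
         DiscGreater H r t (+ r * (+ r - + 1) * (s - + 1) + + r * t) →
         KHChromaticAtMost n r k s (2 Data.Nat.* p H)
lemma3 n zero    k t s {{()}}
lemma3 n (suc r') k t s n≡ H m≤n disc with m≤n⇒∃[o]m+o≡n m≤n
... | d , refl = discrepancyColouring H d (suc r') t _ disc , proper
  where
    proper : ProperKHColouring (m H Data.Nat.+ d) (suc r') k s (2 Data.Nat.* p H) (discrepancyColouring H d (suc r') t _ disc)
    proper vs (_ , sparse) mono with monochromatic⇒uniform H d (suc r') t _ disc vs mono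
    ... | σ , u , uniform =
      ¬uniform-signed _ _ σ (KH-edge-balanced (proj₁ ∘ vs) (proj₂ ∘ vs) sparse n≡ u) uniform
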